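{- For every positive unital commutative lattice-ordered monoid $M$, the algebra $T(M)$ is a unital commutative lattice-ordered monoid.
   Context: A commutative lattice-ordered monoid is an algebra $\langle M;+,\vee,\wedge,0\rangle$ with $\langle M;\vee,\wedge\rangle$ a distributive lattice, $\langle M;+,0\rangle$ a commutative monoid, and $+$ distributing over $\vee$ and $\wedge$. A unital commutative lattice-ordered monoid is an algebra $\langle M;+,\vee,\wedge,0,1,-1\rangle$ whose $\{+,\vee,\wedge,0\}$-reduct is a commutative lattice-ordered monoid, with $-1+1=0$, $0\le1$, and for each $x$ some $n\in\mathbb{N}$ with $(-1)+\dots+(-1)\le x\le1+\dots+1$ ($n$ summands). A positive unital commutative lattice-ordered monoid is an algebra $\langle M;+,\vee,\wedge,0,1,-\ominus1\rangle$ whose $\{+,\vee,\wedge,0\}$-reduct is a commutative lattice-ordered monoid and such that for all $x$: $x\ge0$; $(x+1)\ominus1=x$; $(x\ominus1)+1=x\vee1$; $x\le1+\dots+1$ for some number of summands. Write $n$ for $1+\dots+1$ ($n$ summands). $T(M)$ is the quotient of $M\times\mathbb{N}$ by the equivalence relation $(x,n)\sim(y,m)\iff x+m=y+n$, with classes written $[x,n]$, and operations $0=[0,0]$, $1=[1,0]$, $-1=[0,1]$, $[x,n]+[y,m]=[x+y,n+m]$, $[x,n]\vee[y,m]=[(x+m)\vee(y+n),n+m]$, $[x,n]\wedge[y,m]=[(x+m)\wedge(y+n),n+m]$ (these are well defined). -}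

module Defs where

open import Level using (Level; _⊔_; suc)
open import Data.Nat using (ℕ; zero) renaming (suc to 1+)
open import Data.Product using (_×_; _,_; ∃)
open import Relation.Binary.Core using (Rel)
open import Algebra.Core using (Op₁; Op₂)
open import Algebra.Definitions using (_DistributesOver_; Congruent₁)
open import Algebra.Structures using (IsCommutativeMonoid)
open import Algebra.Lattice.Structures using (IsDistributiveLattice)

times : ∀ {a} {A : Set a} → Op₂ A → A → ℕ → A → A
times _+_ e zero   x = e
times _+_ e (1+ n) x = x + times _+_ e n x

module _ {a ℓ} {A : Set a} (_≈_ : Rel A ℓ) where

  LatLe : Op₂ A → A → A → Set ℓ
  LatLe _∧_ x y = (x ∧ y) ≈ x

  record IsCLoM (_+_ _∨_ _∧_ : Op₂ A) (0# : A) : Set (a ⊔ ℓ) where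
    field
      isDistributiveLattice : IsDistributiveLattice _≈_ _∨_ _∧_
      isCommutativeMonoid   : IsCommutativeMonoid _≈_ _+_ 0#
      +-distrib-∨           : _DistributesOver_ _≈_ _+_ _∨_
      +-distrib-∧           : _DistributesOver_ _≈_ _+_ _∧_

  record IsUCLoM (_+_ _∨_ _∧_ : Op₂ A) (0# 1# -1# : A) : Set (a ⊔ ℓ) where
    field
      isCLoM  : IsCLoM _+_ _∨_ _∧_ 0#
      -1+1≈0  : (-1# + 1#) ≈ 0#
      0≤1     : LatLe _∧_ 0# 1#
      bounded : ∀ x → ∃ λ n → LatLe _∧_ (times _+_ 0# n -1#) x
                              × LatLe _∧_ x (times _+_ 0# n 1#)

  record IsPUCLoM (_+_ _∨_ _∧_ : Op₂ A) (0# 1# : A) (_⊖1 : Op₁ A) : Set (a ⊔ ℓ) where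
    field
      isCLoM   : IsCLoM _+_ _∨_ _∧_ 0#
      ⊖1-cong  : Congruent₁ _≈_ _⊖1
      positive : ∀ x → LatLe _∧_ 0# x
      +1⊖1     : ∀ x → ((x + 1#) ⊖1) ≈ x
      ⊖1+1     : ∀ x → ((x ⊖1) + 1#) ≈ (x ∨ 1#)
      bounded  : ∀ x → ∃ λ n → LatLe _∧_ x (times _+_ 0# n 1#)

record PUCLoM (c ℓ : Level) : Set (suc (c ⊔ ℓ)) where
  infixl 6 _+_
  field
    Carrier  : Set c
    _≈_      : Rel Carrier ℓ
    _+_      : Op₂ Carrier
    _∨_      : Op₂ Carrier
    _∧_      : Op₂ Carrier
    0#       : Carrier
    1#       : Carrier
    _⊖1      : Op₁ Carrier
    isPUCLoM : IsPUCLoM _≈_ _+_ _∨_ _∧_ 0# 1# _⊖1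

module T {c ℓ} (M : PUCLoM c ℓ) where
  open PUCLoM M

  nat : ℕ → Carrier
  nat n = times _+_ 0# n 1#

  TCarrier : Set c
  TCarrier = Carrier × ℕ

  _∼_ : Rel TCarrier ℓ
  (x , n) ∼ (y , m) = (x + nat m) ≈ (y + nat n)

  0T : TCarrier
  0T = (0# , 0)

  1T : TCarrier
  1T = (1# , 0)

  -1T : TCarrier
  -1T = (0# , 1)

  _+T_ : Op₂ TCarrier
  (x , n) +T (y , m) = (x + y , n Data.Nat.+ m)

  _∨T_ : Op₂ TCarrier
  (x , n) ∨T (y , m) = ((x + nat m) ∨ (y + nat n) , n Data.Nat.+ m)

  _∧T_ : Op₂ TCarrier
  (x , n) ∧T (y , m) = ((x + nat m) ∧ (y + nat n) , n Data.Nat.+ m)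

module Submission where

open import Level using (Level)
open import Defs

open import Data.Nat as ℕ using (ℕ; zero; suc)
import Data.Nat.Properties as ℕₚ
open import Data.Product using (_×_; _,_; ∃; proj₁; proj₂)
open import Relation.Binary.PropositionalEquality using (_≡_; refl; cong)
open import Relation.Binary.Structures using (IsEquivalence)
open import Relation.Binary.Bundles using (Setoid)
open import Algebra.Core using (Op₂)
open import Algebra.Definitions
  using (Associative; Commutative; LeftIdentity; RightIdentity;
         _Absorbs_; _DistributesOver_; _DistributesOverˡ_; _DistributesOverʳ_)
open import Algebra.Structures using (IsCommutativeSemigroup; IsCommutativeMonoid; IsCommutativeBand)
open import Algebra.Bundles using (CommutativeSemigroup)
open import Algebra.Lattice.Structures using (IsDistributiveLattice)
open import Algebra.Lattice.Bundles using (Lattice)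
import Algebra.Lattice.Properties.Lattice as LatticeProperties
import Algebra.Properties.CommutativeSemigroup as CommutativeSemigroupProperties
import Relation.Binary.Reasoning.Setoid as SetoidReasoning

-- Read (x , n) as x − n.  Adding 1 is cancellable in M (by ⊖1), which makes ∼
-- transitive, and any finitely many pairs can be moved to a common second
-- component N.  On pairs with the same N, the operations of T(M) act on first
-- components (+ doubling N), so every law of M transfers to T(M).  The bounds
-- come from positivity: 0 ≤ x ≤ k in M gives −(k + n) ≤ x − n ≤ k + n.

module TProperties {c ℓ} (M : PUCLoM c ℓ) where
  open PUCLoM M renaming (_≈_ to infix 4 _≈_)
  open T M renaming (_∼_ to infix 4 _∼_; _+T_ to infixl 6 _+T_)
  open IsPUCLoM isPUCLoM hiding (isCLoM)
  open IsCLoM (IsPUCLoM.isCLoM isPUCLoM)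
  open IsDistributiveLattice isDistributiveLattice
    using (isLattice; ∧-congˡ; ∧-congʳ; ∧-assoc; ∨-absorbs-∧; ∧-absorbs-∨;
           ∨-distrib-∧; ∧-distrib-∨)
    renaming (refl to ≈-refl; sym to ≈-sym; trans to ≈-trans)
  open IsCommutativeMonoid isCommutativeMonoid
    using (setoid; ∙-cong; ∙-congˡ; ∙-congʳ; assoc; comm; identityˡ; identityʳ)

  +-commutativeSemigroup : CommutativeSemigroup c ℓ
  +-commutativeSemigroup = record
    { isCommutativeSemigroup = IsCommutativeMonoid.isCommutativeSemigroup isCommutativeMonoid }

  lattice : Lattice c ℓ
  lattice = record { isLattice = isLattice }

  open CommutativeSemigroupProperties +-commutativeSemigroup
    using (interchange; xy∙z≈xz∙y; x∙yz≈xz∙y)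
  open CommutativeSemigroupProperties ℕₚ.+-commutativeSemigroup
    using () renaming (x∙yz≈y∙xz to ℕ-x∙yz≈y∙xz; x∙yz≈y∙zx to ℕ-x∙yz≈y∙zx)
  open LatticeProperties lattice
    using (∨-isSemilattice; ∧-isSemilattice)

  infix 4 _≤_
  _≤_ : Carrier → Carrier → Set ℓ
  _≤_ = LatLe _≈_ _∧_

  nat-+ : ∀ i j → nat (i ℕ.+ j) ≈ nat i + nat j
  nat-+ zero    j = ≈-sym (identityˡ (nat j))
  nat-+ (suc i) j = ≈-trans (∙-congˡ (nat-+ i j)) (≈-sym (assoc 1# (nat i) (nat j)))

  +-nat-assoc : ∀ a i j → (a + nat i) + nat j ≈ a + nat (i ℕ.+ j)
  +-nat-assoc a i j = ≈-trans (assoc a (nat i) (nat j)) (∙-congˡ (≈-sym (nat-+ i j)))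

  +-nat-exchange : ∀ a i j k → (a + nat i) + nat (j ℕ.+ k) ≈ (a + nat j) + nat (i ℕ.+ k)
  +-nat-exchange a i j k = begin
    (a + nat i) + nat (j ℕ.+ k)    ≈⟨ +-nat-assoc a i (j ℕ.+ k) ⟩
    a + nat (i ℕ.+ (j ℕ.+ k))      ≡⟨ cong (λ s → a + nat s) (ℕ-x∙yz≈y∙xz i j k) ⟩
    a + nat (j ℕ.+ (i ℕ.+ k))      ≈⟨ +-nat-assoc a j (i ℕ.+ k) ⟨
    (a + nat j) + nat (i ℕ.+ k)    ∎
    where open SetoidReasoning setoid

  +1-cancelʳ : ∀ {x y} → x + 1# ≈ y + 1# → x ≈ y
  +1-cancelʳ {x} {y} eq = begin
    x               ≈⟨ +1⊖1 x ⟨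
    (x + 1#) ⊖1     ≈⟨ ⊖1-cong eq ⟩
    (y + 1#) ⊖1     ≈⟨ +1⊖1 y ⟩
    y               ∎
    where open SetoidReasoning setoid

  +-nat-cancelʳ : ∀ k {x y} → x + nat k ≈ y + nat k → x ≈ y
  +-nat-cancelʳ zero    {x} {y} eq = ≈-trans (≈-sym (identityʳ x)) (≈-trans eq (identityʳ y))
  +-nat-cancelʳ (suc k) {x} {y} eq = +-nat-cancelʳ k (+1-cancelʳ (begin
    (x + nat k) + 1#    ≈⟨ x∙yz≈xz∙y x 1# (nat k) ⟨
    x + (1# + nat k)    ≈⟨ eq ⟩
    y + (1# + nat k)    ≈⟨ x∙yz≈xz∙y y 1# (nat k) ⟩
    (y + nat k) + 1#    ∎))
    where open SetoidReasoning setoid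

  x≤x+y : ∀ x y → x ≤ x + y
  x≤x+y x y = begin
    x ∧ (x + y)          ≈⟨ ∧-congʳ (identityʳ x) ⟨
    (x + 0#) ∧ (x + y)   ≈⟨ proj₁ +-distrib-∧ x 0# y ⟨
    x + (0# ∧ y)         ≈⟨ ∙-congˡ (positive y) ⟩
    x + 0#               ≈⟨ identityʳ x ⟩
    x                    ∎
    where open SetoidReasoning setoid

  x≤y⇒x≤y+z : ∀ {x y} z → x ≤ y → x ≤ y + z
  x≤y⇒x≤y+z {x} {y} z x≤y = begin
    x ∧ (y + z)          ≈⟨ ∧-congʳ x≤y ⟨
    (x ∧ y) ∧ (y + z)    ≈⟨ ∧-assoc x y (y + z) ⟩
    x ∧ (y ∧ (y + z))    ≈⟨ ∧-congˡ (x≤x+y y z) ⟩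
    x ∧ y                ≈⟨ x≤y ⟩
    x                    ∎
    where open SetoidReasoning setoid

  ∼-trans : ∀ {p q r} → p ∼ q → q ∼ r → p ∼ r
  ∼-trans {x , n} {y , m} {z , k} x∼y y∼z = +-nat-cancelʳ m (begin
    (x + nat k) + nat m   ≈⟨ xy∙z≈xz∙y x (nat k) (nat m) ⟩
    (x + nat m) + nat k   ≈⟨ ∙-congʳ x∼y ⟩
    (y + nat n) + nat k   ≈⟨ xy∙z≈xz∙y y (nat n) (nat k) ⟩
    (y + nat k) + nat n   ≈⟨ ∙-congʳ y∼z ⟩
    (z + nat m) + nat n   ≈⟨ xy∙z≈xz∙y z (nat m) (nat n) ⟩
    (z + nat n) + nat m   ∎)
    where open SetoidReasoning setoid

  ∼-isEquivalence : IsEquivalence _∼_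
  ∼-isEquivalence = record
    { refl  = ≈-refl
    ; sym   = ≈-sym
    ; trans = λ {p} {q} {r} → ∼-trans {p} {q} {r}
    }

  -- Unlike ∼, the wrapper ≋ lets Agda infer the related pairs from a proof.
  infix 4 _≋_
  record _≋_ (p q : TCarrier) : Set ℓ where
    constructor ⟨_⟩
    field ≋⇒∼ : p ∼ q
  open _≋_

  ≋-refl : ∀ {p} → p ≋ p
  ≋-refl = ⟨ ≈-refl ⟩

  ≋-sym : ∀ {p q} → p ≋ q → q ≋ p
  ≋-sym ⟨ p∼q ⟩ = ⟨ ≈-sym p∼q ⟩

  ≋-trans : ∀ {p q r} → p ≋ q → q ≋ r → p ≋ r
  ≋-trans {p} {q} {r} ⟨ p∼q ⟩ ⟨ q∼r ⟩ = ⟨ ∼-trans {p} {q} {r} p∼q q∼r ⟩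

  ≋-setoid : Setoid c ℓ
  ≋-setoid = record
    { Carrier       = TCarrier
    ; _≈_           = _≋_
    ; isEquivalence = record { refl = ≋-refl ; sym = ≋-sym ; trans = ≋-trans } }

  ≈⇒∼ : ∀ {a b n m} → a ≈ b → n ≡ m → (a , n) ∼ (b , m)
  ≈⇒∼ a≈b refl = ∙-congʳ a≈b

  ≈⇒≋ : ∀ {a b n m} → a ≈ b → n ≡ m → (a , n) ≋ (b , m)
  ≈⇒≋ a≈b n≡m = ⟨ ≈⇒∼ a≈b n≡m ⟩

  ≋-lift : ∀ {x n} d {N} → n ℕ.+ d ≡ N → (x , n) ≋ (x + nat d , N)
  ≋-lift {x} {n} d refl = ⟨ begin
    x + nat (n ℕ.+ d)     ≡⟨ cong (λ s → x + nat s) (ℕₚ.+-comm n d) ⟩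
    x + nat (d ℕ.+ n)     ≈⟨ +-nat-assoc x d n ⟨
    (x + nat d) + nat n   ∎ ⟩
    where open SetoidReasoning setoid

  ≋-via : ∀ {p q a b N} → p ≋ (a , N) → q ≋ (b , N) → a ≈ b → p ≋ q
  ≋-via p≋a q≋b a≈b = ≋-trans p≋a (≋-trans (≈⇒≋ a≈b refl) (≋-sym q≋b))

  module Align₂ (p q : TCarrier) where
    N : ℕ
    N = proj₂ p ℕ.+ proj₂ q

    x y : Carrier
    x = proj₁ p + nat (proj₂ q)
    y = proj₁ q + nat (proj₂ p)

    p≋ : p ≋ (x , N)
    p≋ = ≋-lift (proj₂ q) refl

    q≋ : q ≋ (y , N)
    q≋ = ≋-lift (proj₂ p) (ℕₚ.+-comm (proj₂ q) (proj₂ p))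

  module Align₃ (p q r : TCarrier) where
    N : ℕ
    N = proj₂ p ℕ.+ (proj₂ q ℕ.+ proj₂ r)

    x y z : Carrier
    x = proj₁ p + nat (proj₂ q ℕ.+ proj₂ r)
    y = proj₁ q + nat (proj₂ p ℕ.+ proj₂ r)
    z = proj₁ r + nat (proj₂ p ℕ.+ proj₂ q)

    p≋ : p ≋ (x , N)
    p≋ = ≋-lift (proj₂ q ℕ.+ proj₂ r) refl

    q≋ : q ≋ (y , N)
    q≋ = ≋-lift (proj₂ p ℕ.+ proj₂ r) (ℕ-x∙yz≈y∙xz (proj₂ q) (proj₂ p) (proj₂ r))

    r≋ : r ≋ (z , N)
    r≋ = ≋-lift (proj₂ p ℕ.+ proj₂ q) (ℕ-x∙yz≈y∙zx (proj₂ r) (proj₂ p) (proj₂ q))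

  +T-cong : ∀ {p p′ q q′} → p ≋ p′ → q ≋ q′ → p +T q ≋ p′ +T q′
  +T-cong {x , n} {x′ , n′} {y , m} {y′ , m′} ⟨ x∼x′ ⟩ ⟨ y∼y′ ⟩ = ⟨ begin
    (x + y) + nat (n′ ℕ.+ m′)      ≈⟨ ∙-congˡ (nat-+ n′ m′) ⟩
    (x + y) + (nat n′ + nat m′)    ≈⟨ interchange x y (nat n′) (nat m′) ⟩
    (x + nat n′) + (y + nat m′)    ≈⟨ ∙-cong x∼x′ y∼y′ ⟩
    (x′ + nat n) + (y′ + nat m)    ≈⟨ interchange x′ (nat n) y′ (nat m) ⟩
    (x′ + y′) + (nat n + nat m)    ≈⟨ ∙-congˡ (nat-+ n m) ⟨
    (x′ + y′) + nat (n ℕ.+ m)      ∎ ⟩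
    where open SetoidReasoning setoid

  +T-assoc : Associative _∼_ _+T_
  +T-assoc (x , n) (y , m) (z , k) = ≈⇒∼ (assoc x y z) (ℕₚ.+-assoc n m k)

  +T-comm : Commutative _∼_ _+T_
  +T-comm (x , n) (y , m) = ≈⇒∼ (comm x y) (ℕₚ.+-comm n m)

  +T-identityˡ : LeftIdentity _∼_ 0T _+T_
  +T-identityˡ (x , n) = ≈⇒∼ {n = n} (identityˡ x) refl

  +T-identityʳ : RightIdentity _∼_ 0T _+T_
  +T-identityʳ (x , n) = ≈⇒∼ (identityʳ x) (ℕₚ.+-identityʳ n)

  +T-isCommutativeMonoid : IsCommutativeMonoid _∼_ _+T_ 0T
  +T-isCommutativeMonoid = record
    { isMonoid = record
      { isSemigroup = record
        { isMagma = record
          { isEquivalence = ∼-isEquivalence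
          ; ∙-cong = λ {p p′ q q′} p∼p′ q∼q′ → ≋⇒∼ (+T-cong {p} {p′} {q} {q′} ⟨ p∼p′ ⟩ ⟨ q∼q′ ⟩)
          }
        ; assoc = +T-assoc
        }
      ; identity = +T-identityˡ , +T-identityʳ
      }
    ; comm = +T-comm
    }

  -- At ⊔ = ∨ and ⊔ = ∧, the lifted _⊔T_ is definitionally _∨T_ and _∧T_.

  module LiftedOp {_⊔_ : Op₂ Carrier}
    (⊔-isCommutativeSemigroup : IsCommutativeSemigroup _≈_ _⊔_)
    (+-distrib-⊔ : _DistributesOver_ _≈_ _+_ _⊔_)
    where
    open IsCommutativeSemigroup ⊔-isCommutativeSemigroup
      using () renaming (∙-cong to ⊔-cong; assoc to ⊔-assoc; comm to ⊔-comm)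

    infixr 5 _⊔T_
    _⊔T_ : Op₂ TCarrier
    (x , n) ⊔T (y , m) = ((x + nat m) ⊔ (y + nat n) , n ℕ.+ m)

    ⊔T-comm : ∀ p q → p ⊔T q ≋ q ⊔T p
    ⊔T-comm (x , n) (y , m) = ≈⇒≋ (⊔-comm (x + nat m) (y + nat n)) (ℕₚ.+-comm n m)

    ⊔T-congʳ : ∀ {p p′ q} → p ≋ p′ → p ⊔T q ≋ p′ ⊔T q
    ⊔T-congʳ {x , n} {x′ , n′} {y , m} ⟨ x∼x′ ⟩ = ⟨ begin
      ((x + nat m) ⊔ (y + nat n)) + nat (n′ ℕ.+ m)
        ≈⟨ proj₂ +-distrib-⊔ _ _ _ ⟩
      ((x + nat m) + nat (n′ ℕ.+ m)) ⊔ ((y + nat n) + nat (n′ ℕ.+ m))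
        ≈⟨ ⊔-cong (+-nat-exchange x m n′ m) (+-nat-exchange y n n′ m) ⟩
      ((x + nat n′) + nat (m ℕ.+ m)) ⊔ ((y + nat n′) + nat (n ℕ.+ m))
        ≈⟨ ⊔-cong (∙-congʳ x∼x′) ≈-refl ⟩
      ((x′ + nat n) + nat (m ℕ.+ m)) ⊔ ((y + nat n′) + nat (n ℕ.+ m))
        ≈⟨ ⊔-cong (+-nat-exchange x′ n m m) ≈-refl ⟩
      ((x′ + nat m) + nat (n ℕ.+ m)) ⊔ ((y + nat n′) + nat (n ℕ.+ m))
        ≈⟨ proj₂ +-distrib-⊔ _ _ _ ⟨
      ((x′ + nat m) ⊔ (y + nat n′)) + nat (n ℕ.+ m) ∎ ⟩
      where open SetoidReasoning setoid

    ⊔T-cong : ∀ {p p′ q q′} → p ≋ p′ → q ≋ q′ → p ⊔T q ≋ p′ ⊔T q′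
    ⊔T-cong {p} {p′} {q} {q′} p≋p′ q≋q′ = begin
      p ⊔T q     ≈⟨ ⊔T-congʳ p≋p′ ⟩
      p′ ⊔T q    ≈⟨ ⊔T-comm p′ q ⟩
      q ⊔T p′    ≈⟨ ⊔T-congʳ q≋q′ ⟩
      q′ ⊔T p′   ≈⟨ ⊔T-comm q′ p′ ⟩
      p′ ⊔T q′   ∎
      where open SetoidReasoning ≋-setoid

    ⊔T-aligned : ∀ {p q a b N} → p ≋ (a , N) → q ≋ (b , N) → p ⊔T q ≋ (a ⊔ b , N)
    ⊔T-aligned {a = a} {b} {N} p≋a q≋b = ≋-trans (⊔T-cong p≋a q≋b) ⟨ begin
      ((a + nat N) ⊔ (b + nat N)) + nat N   ≈⟨ ∙-congʳ (proj₂ +-distrib-⊔ (nat N) a b) ⟨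
      ((a ⊔ b) + nat N) + nat N             ≈⟨ +-nat-assoc (a ⊔ b) N N ⟩
      (a ⊔ b) + nat (N ℕ.+ N)               ∎ ⟩
      where open SetoidReasoning setoid

    ⊔T-assoc : ∀ p q r → (p ⊔T q) ⊔T r ≋ p ⊔T (q ⊔T r)
    ⊔T-assoc p q r = ≋-via (⊔T-aligned (⊔T-aligned p≋ q≋) r≋) (⊔T-aligned p≋ (⊔T-aligned q≋ r≋))
                           (⊔-assoc x y z)
      where open Align₃ p q r

    +T-distribˡ-⊔T : ∀ p q r → p +T (q ⊔T r) ≋ (p +T q) ⊔T (p +T r)
    +T-distribˡ-⊔T p q r =
      ≋-via (+T-cong p≋ (⊔T-aligned q≋ r≋)) (⊔T-aligned (+T-cong p≋ q≋) (+T-cong p≋ r≋))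
            (proj₁ +-distrib-⊔ x y z)
      where open Align₃ p q r

    +T-distribʳ-⊔T : ∀ p q r → (q ⊔T r) +T p ≋ (q +T p) ⊔T (r +T p)
    +T-distribʳ-⊔T p q r =
      ≋-via (+T-cong (⊔T-aligned q≋ r≋) p≋) (⊔T-aligned (+T-cong q≋ p≋) (+T-cong r≋ p≋))
            (proj₂ +-distrib-⊔ x y z)
      where open Align₃ p q r

    ⊔T-isCommutativeSemigroup : IsCommutativeSemigroup _∼_ _⊔T_
    ⊔T-isCommutativeSemigroup = record
      { isSemigroup = record
        { isMagma = record
          { isEquivalence = ∼-isEquivalence
          ; ∙-cong = λ {p p′ q q′} p∼p′ q∼q′ → ≋⇒∼ (⊔T-cong {p} {p′} {q} {q′} ⟨ p∼p′ ⟩ ⟨ q∼q′ ⟩)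
          }
        ; assoc = λ p q r → ≋⇒∼ (⊔T-assoc p q r)
        }
      ; comm = λ p q → ≋⇒∼ (⊔T-comm p q)
      }

    +T-distrib-⊔T : _DistributesOver_ _∼_ _+T_ _⊔T_
    +T-distrib-⊔T = (λ p q r → ≋⇒∼ (+T-distribˡ-⊔T p q r))
                  , (λ p q r → ≋⇒∼ (+T-distribʳ-⊔T p q r))

  module LiftedPair {_⊔_ _⊓_ : Op₂ Carrier}
    (⊔-isCommutativeSemigroup : IsCommutativeSemigroup _≈_ _⊔_)
    (+-distrib-⊔ : _DistributesOver_ _≈_ _+_ _⊔_)
    (⊓-isCommutativeSemigroup : IsCommutativeSemigroup _≈_ _⊓_)
    (+-distrib-⊓ : _DistributesOver_ _≈_ _+_ _⊓_)
    where
    open LiftedOp ⊔-isCommutativeSemigroup +-distrib-⊔ using (_⊔T_; ⊔T-aligned)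
    open LiftedOp ⊓-isCommutativeSemigroup +-distrib-⊓
      using () renaming (_⊔T_ to _⊓T_; ⊔T-aligned to ⊓T-aligned)

    ⊔T-absorbs-⊓T : _Absorbs_ _≈_ _⊔_ _⊓_ → _Absorbs_ _∼_ _⊔T_ _⊓T_
    ⊔T-absorbs-⊓T ⊔-absorbs-⊓ p q =
      ≋⇒∼ (≋-via (⊔T-aligned p≋ (⊓T-aligned p≋ q≋)) p≋ (⊔-absorbs-⊓ x y))
      where open Align₂ p q

    ⊔T-distribˡ-⊓T : _DistributesOverˡ_ _≈_ _⊔_ _⊓_ → _DistributesOverˡ_ _∼_ _⊔T_ _⊓T_
    ⊔T-distribˡ-⊓T ⊔-distribˡ-⊓ p q r =
      ≋⇒∼ (≋-via (⊔T-aligned p≋ (⊓T-aligned q≋ r≋))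
                 (⊓T-aligned (⊔T-aligned p≋ q≋) (⊔T-aligned p≋ r≋))
                 (⊔-distribˡ-⊓ x y z))
      where open Align₃ p q r

    ⊔T-distribʳ-⊓T : _DistributesOverʳ_ _≈_ _⊔_ _⊓_ → _DistributesOverʳ_ _∼_ _⊔T_ _⊓T_
    ⊔T-distribʳ-⊓T ⊔-distribʳ-⊓ p q r =
      ≋⇒∼ (≋-via (⊔T-aligned (⊓T-aligned q≋ r≋) p≋)
                 (⊓T-aligned (⊔T-aligned q≋ p≋) (⊔T-aligned r≋ p≋))
                 (⊔-distribʳ-⊓ x y z))
      where open Align₃ p q r

    ⊔T-distrib-⊓T : _DistributesOver_ _≈_ _⊔_ _⊓_ → _DistributesOver_ _∼_ _⊔T_ _⊓T_
    ⊔T-distrib-⊓T (⊔-distribˡ-⊓ , ⊔-distribʳ-⊓) =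
      ⊔T-distribˡ-⊓T ⊔-distribˡ-⊓ , ⊔T-distribʳ-⊓T ⊔-distribʳ-⊓

  ∨-isCommutativeSemigroup : IsCommutativeSemigroup _≈_ _∨_
  ∨-isCommutativeSemigroup = IsCommutativeBand.isCommutativeSemigroup ∨-isSemilattice

  ∧-isCommutativeSemigroup : IsCommutativeSemigroup _≈_ _∧_
  ∧-isCommutativeSemigroup = IsCommutativeBand.isCommutativeSemigroup ∧-isSemilattice

  module Join = LiftedOp ∨-isCommutativeSemigroup +-distrib-∨
  module Meet = LiftedOp ∧-isCommutativeSemigroup +-distrib-∧
  module JoinMeet = LiftedPair ∨-isCommutativeSemigroup +-distrib-∨ ∧-isCommutativeSemigroup +-distrib-∧
  module MeetJoin = LiftedPair ∧-isCommutativeSemigroup +-distrib-∧ ∨-isCommutativeSemigroup +-distrib-∨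

  ∨T-∧T-isDistributiveLattice : IsDistributiveLattice _∼_ _∨T_ _∧T_
  ∨T-∧T-isDistributiveLattice = record
    { isLattice = record
      { isEquivalence = ∼-isEquivalence
      ; ∨-comm        = IsCommutativeSemigroup.comm Join.⊔T-isCommutativeSemigroup
      ; ∨-assoc       = IsCommutativeSemigroup.assoc Join.⊔T-isCommutativeSemigroup
      ; ∨-cong        = λ {p p′ q q′} → IsCommutativeSemigroup.∙-cong Join.⊔T-isCommutativeSemigroup {p} {p′} {q} {q′}
      ; ∧-comm        = IsCommutativeSemigroup.comm Meet.⊔T-isCommutativeSemigroup
      ; ∧-assoc       = IsCommutativeSemigroup.assoc Meet.⊔T-isCommutativeSemigroup
      ; ∧-cong        = λ {p p′ q q′} → IsCommutativeSemigroup.∙-cong Meet.⊔T-isCommutativeSemigroup {p} {p′} {q} {q′}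
      ; absorptive    = JoinMeet.⊔T-absorbs-⊓T ∨-absorbs-∧ , MeetJoin.⊔T-absorbs-⊓T ∧-absorbs-∨
      }
    ; ∨-distrib-∧ = JoinMeet.⊔T-distrib-⊓T ∨-distrib-∧
    ; ∧-distrib-∨ = MeetJoin.⊔T-distrib-⊓T ∧-distrib-∨
    }

  T-isCLoM : IsCLoM _∼_ _+T_ _∨T_ _∧T_ 0T
  T-isCLoM = record
    { isDistributiveLattice = ∨T-∧T-isDistributiveLattice
    ; isCommutativeMonoid   = +T-isCommutativeMonoid
    ; +-distrib-∨           = Join.+T-distrib-⊔T
    ; +-distrib-∧           = Meet.+T-distrib-⊔T
    }

  -1T+1T∼0T : -1T +T 1T ∼ 0T
  -1T+1T∼0T = assoc 0# 1# 0#

  times-1T : ∀ j → times _+T_ 0T j 1T ≋ (nat j , 0)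
  times-1T zero    = ≋-refl
  times-1T (suc j) = +T-cong (≋-refl {1T}) (times-1T j)

  times-−1T : ∀ j → times _+T_ 0T j -1T ≋ (0# , j)
  times-−1T zero    = ≋-refl
  times-−1T (suc j) = ≋-trans (+T-cong (≋-refl { -1T}) (times-−1T j)) (≈⇒≋ (identityˡ 0#) refl)

  ≤T-aligned : ∀ {p q a b N} → p ≋ (a , N) → q ≋ (b , N) → a ≤ b → LatLe _∼_ _∧T_ p q
  ≤T-aligned p≋a q≋b a≤b = ≋⇒∼ (≋-via (Meet.⊔T-aligned p≋a q≋b) p≋a a≤b)

  0T≤1T : LatLe _∼_ _∧T_ 0T 1T
  0T≤1T = ≤T-aligned (≋-refl {0T}) (≋-refl {1T}) (positive 1#)

  T-bounded : ∀ p → ∃ λ j → LatLe _∼_ _∧T_ (times _+T_ 0T j -1T) p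
                          × LatLe _∼_ _∧T_ p (times _+T_ 0T j 1T)
  T-bounded (x , n) with bounded x
  ... | k , x≤k = k ℕ.+ n , lower , upper
    where
    lower : LatLe _∼_ _∧T_ (times _+T_ 0T (k ℕ.+ n) -1T) (x , n)
    lower = ≤T-aligned (times-−1T (k ℕ.+ n)) (≋-lift k (ℕₚ.+-comm n k)) (positive (x + nat k))

    x≤k+n+n : x ≤ nat (k ℕ.+ n) + nat n
    x≤k+n+n = ≈-trans (∧-congˡ (≈-trans (∙-congʳ (nat-+ k n)) (assoc (nat k) (nat n) (nat n))))
                      (x≤y⇒x≤y+z (nat n + nat n) x≤k)

    upper : LatLe _∼_ _∧T_ (x , n) (times _+T_ 0T (k ℕ.+ n) 1T)
    upper = ≤T-aligned ≋-refl (≋-trans (times-1T (k ℕ.+ n)) (≋-lift n refl)) x≤k+n+n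

proposition4p7 : ∀ {c ℓ : Level} (M : PUCLoM c ℓ) →
    IsUCLoM (T._∼_ M) (T._+T_ M) (T._∨T_ M) (T._∧T_ M) (T.0T M) (T.1T M) (T.-1T M)
proposition4p7 M = record
  { isCLoM  = T-isCLoM
  ; -1+1≈0  = -1T+1T∼0T
  ; 0≤1     = 0T≤1T
  ; bounded = T-bounded
  }
  where open TProperties M
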